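{- Let $G$ be a bipartite graph with vertex classes $V^+$ and $V^-$, let $L:V^+\cup V^-\to\mathcal{P}(\mathbb{N})$ be a list assignment for $G$, and let $i,j$ be distinct positive integers. Then $\|C_{ij}(L)\|\ge \|L\|$.
   Context: A list assignment for $G$ is a function $L$ assigning to each vertex a set of positive integers; an $L$-colouring is a proper colouring $c$ of $G$ (adjacent vertices get different colours) with $c(v)\in L(v)$ for all $v$, and $\|L\|$ denotes the number of $L$-colourings of $G$. For distinct positive integers $i,j$ and $S\subseteq\mathbb{N}$, the $ij$-compression is $C_{ij}(S)=(S\cup\{i\})\setminus\{j\}$ if $j\in S$ and $i\notin S$, and $C_{ij}(S)=S$ otherwise. For a bipartite graph with classes $V^+,V^-$, the $ij$-compression $C_{ij}(L)$ of $L$ is the list assignment with $(C_{ij}(L))(v)=C_{ij}(L(v))$ for $v\in V^+$ and $(C_{ij}(L))(v)=C_{ji}(L(v))$ for $v\in V^-$. -}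

module Defs where

open import Data.Nat using (ℕ; zero; suc; _≡ᵇ_)
open import Data.Bool using (Bool; true; false; _∧_; _∨_; not; if_then_else_)
open import Data.Fin using (Fin; toℕ)
open import Data.List using (List; []; _∷_; map; concatMap; filter; length; allFin; foldr)
open import Data.Product using (_,_)
open import Relation.Binary.PropositionalEquality using (_≡_)
open import Relation.Nullary using (¬_)
open import Relation.Nullary.Decidable using (T?)

record Graph (n : ℕ) : Set where
  field
    adj   : Fin n → Fin n → Bool
    sym   : ∀ u v → adj u v ≡ adj v u
    irrfl : ∀ v → adj v v ≡ false
open Graph public

-- A bipartition: side v ≡ true means v ∈ V⁺, side v ≡ false means v ∈ V⁻;
-- every edge joins V⁺ to V⁻.
IsBipartition : ∀ {n} → Graph n → (Fin n → Bool) → Set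
IsBipartition G side = ∀ u v → adj G u v ≡ true → ¬ (side u ≡ side v)

NSet : Set
NSet = ℕ → Bool

ListAssignment : ℕ → Set
ListAssignment n = Fin n → NSet

Cset : ℕ → ℕ → NSet → NSet
Cset i j S x =
  if S j ∧ not (S i)
  then (if x ≡ᵇ i then true else if x ≡ᵇ j then false else S x)
  else S x

CL : ∀ {n} → (Fin n → Bool) → ℕ → ℕ → ListAssignment n → ListAssignment n
CL side i j L v = if side v then Cset i j (L v) else Cset j i (L v)

allFuns : (n K : ℕ) → List (Fin n → Fin K)
allFuns zero K = (λ ()) ∷ []
allFuns (suc n) K =
  concatMap (λ a → map (λ f → cons a f) (allFuns n K)) (allFin K)
  where
  cons : Fin K → (Fin n → Fin K) → Fin (suc n) → Fin K
  cons a f Fin.zero = a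
  cons a f (Fin.suc x) = f x

allB : {A : Set} → (A → Bool) → List A → Bool
allB p = foldr (λ x b → p x ∧ b) true

isLColouring : ∀ {n K} → Graph n → ListAssignment n → (Fin n → Fin K) → Bool
isLColouring {n} G L c =
  allB (λ v → L v (toℕ (c v))) (allFin n) ∧
  allB (λ u → allB (λ v → not (adj G u v) ∨ not (toℕ (c u) ≡ᵇ toℕ (c v))) (allFin n)) (allFin n)

-- ‖L‖ computed with all colours below the bound K (correct whenever every
-- list L v is contained in {0,…,K-1}).
countCol : ∀ {n} → (K : ℕ) → Graph n → ListAssignment n → ℕ
countCol {n} K G L = length (filter (λ c → T? (isLColouring G L c)) (allFuns n K))

-- Given an L-colouring c, call a vertex a misfit if its colour is
-- missing from its compressed list.  On V⁺ the compression C_ij only trades j for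
-- i (and on V⁻ only i for j), so a misfit on V⁺ has colour j and i ∉ L(v), and a
-- misfit on V⁻ has colour i and j ∉ L(v).  Let S be the union of the {i,j}-Kempe
-- chains of c through the misfits.  Since G is bipartite and c is proper, S is
-- coloured like its misfits: j on V⁺ and i on V⁻.  Swapping i and j on S gives a
-- C_ij(L)-colouring, because each swapped vertex gains the colour that the
-- compression moved into its list.  The map is injective: S is recovered from the
-- swapped colouring as the Kempe closure of the vertices whose new colour is not
-- in L.  Counting colourings is then a pigeonhole argument on the enumeration of
-- all maps Fin n → Fin K.
module Submission where

open import Data.Bool using (Bool; true; false; T; not; _∨_; if_then_else_)
open import Data.Bool.Properties using (T-∧; T-≡; T?)
open import Data.Fin using (Fin; zero; suc; toℕ; fromℕ<)
open import Data.Fin.Properties using (toℕ-injective; _≟_; toℕ-fromℕ<; fromℕ<-injective; any?)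
open import Data.Fin.Subset as Subset using (Subset; _∈_; _∉_; _∪_; ⁅_⁆; _⊃_)
open import Data.Fin.Subset.Properties using (_∈?_; p⊆p∪q; x∈p∪q⁺; x∈p∪q⁻; x∈⁅x⁆; x∈⁅y⁆⇒x≡y; ∉⊥)
open import Data.Fin.Subset.Induction using (⊃-wellFounded)
open import Data.List using (List; []; _∷_; length; filter; allFin)
open import Data.List.Properties using (length-removeAt′)
open import Data.List.Membership.Propositional using (lose)
open import Data.List.Membership.Propositional.Properties using (∈-allFin)
import Data.List.Membership.Setoid as SetoidMembership
open import Data.List.Membership.Setoid.Properties
  using (∈-resp-≈; ∈-filter⁺; ∈-filter⁻; ∈-map⁺; ∈-concatMap⁺)
open import Data.List.Relation.Binary.Disjoint.Setoid using (Disjoint)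
import Data.List.Relation.Unary.All as All
import Data.List.Relation.Unary.All.Properties as All
open import Data.List.Relation.Unary.All using ([])
import Data.List.Relation.Unary.AllPairs as AllPairs
import Data.List.Relation.Unary.AllPairs.Properties as AllPairs
open import Data.List.Relation.Unary.AllPairs using ([]; _∷_)
open import Data.List.Relation.Unary.Any using (here; there; index)
open import Data.List.Relation.Unary.Enumerates.Setoid using (IsEnumeration)
open import Data.List.Relation.Unary.Unique.Setoid using (Unique)
import Data.List.Relation.Unary.Unique.Setoid.Properties as Uniqueₚ
open import Data.List.Relation.Unary.Unique.Propositional.Properties using (allFin⁺)
open import Data.Nat using (ℕ; zero; suc; _≤_; _<_; z≤n; s≤s; _≡ᵇ_)
open import Data.Nat.Properties using (≡ᵇ⇒≡; ≡⇒≡ᵇ; module ≤-Reasoning)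
open import Data.Product using (_×_; _,_; proj₁; proj₂; ∃)
open import Data.Product.Function.NonDependent.Propositional using (_×-⇔_)
open import Data.Sum using (_⊎_; inj₁; inj₂; [_,_]; [_,_]′)
open import Data.Unit using (tt)
open import Function using (_∘_; id)
open import Function.Bundles using (_⇔_; mk⇔; Equivalence)
open import Function.Properties.Equivalence using () renaming (trans to ⇔-trans)
open import Induction.WellFounded using (Acc; acc)
open import Level using (0ℓ)
open import Relation.Binary using (Setoid; Rel; _Respects_) renaming (Decidable to Decidable₂)
open import Relation.Binary.PropositionalEquality
  using (_≡_; _≢_; _≗_; refl; sym; trans; cong; subst; subst₂; setoid; _→-setoid_)
open import Relation.Nullary using (¬_; contradiction; Dec; does; yes; no; ¬?; _×-dec_; _⊎-dec_)
open import Relation.Nullary.Decidable using (decidable-stable; toSum)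
open import Relation.Unary using (Pred; Decidable; _⊆_)

open import Defs hiding (sym)

module _ {a b ℓ₁ ℓ₂} (S₁ : Setoid a ℓ₁) (S₂ : Setoid b ℓ₂) where
  open Setoid S₁ using () renaming (Carrier to A; _≈_ to _≈₁_; refl to ≈₁-refl)
  open Setoid S₂ using () renaming (Carrier to B; _≈_ to _≈₂_; sym to ≈₂-sym; trans to ≈₂-trans)
  open SetoidMembership S₁ using () renaming (_∈_ to _∈₁_)
  open SetoidMembership S₂ using (_─_) renaming (_∈_ to _∈₂_)

  ∈-─ : ∀ {x y ys} (x∈ys : x ∈₂ ys) → y ∈₂ ys → ¬ x ≈₂ y → y ∈₂ ys ─ x∈ys
  ∈-─ (here x≈w)  (here y≈w)  x≉y = contradiction (≈₂-trans x≈w (≈₂-sym y≈w)) x≉y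
  ∈-─ (here _)    (there y∈ys) _  = y∈ys
  ∈-─ (there _)   (here y≈w)  _   = here y≈w
  ∈-─ (there x∈ys) (there y∈ys) x≉y = there (∈-─ x∈ys y∈ys x≉y)

  length-≤-by-injection : ∀ {f : A → B} {xs ys} → Unique S₁ xs →
                          (∀ {x} → x ∈₁ xs → f x ∈₂ ys) →
                          (∀ {x y} → x ∈₁ xs → y ∈₁ xs → f x ≈₂ f y → x ≈₁ y) →
                          length xs ≤ length ys
  length-≤-by-injection {xs = []} _ _ _ = z≤n
  length-≤-by-injection {f} {x ∷ xs} {ys} x∷xs!@(_ ∷ xs!) maps inj = begin
    suc (length xs)           ≤⟨ s≤s (length-≤-by-injection xs! maps′ (λ x∈ y∈ → inj (there x∈) (there y∈))) ⟩
    suc (length (ys ─ fx∈ys)) ≡⟨ sym (length-removeAt′ ys (index fx∈ys)) ⟩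
    length ys                 ∎
    where
    open ≤-Reasoning
    fx∈ys : f x ∈₂ ys
    fx∈ys = maps (here ≈₁-refl)
    maps′ : ∀ {y} → y ∈₁ xs → f y ∈₂ ys ─ fx∈ys
    maps′ y∈xs = ∈-─ fx∈ys (maps (there y∈xs))
      (λ fx≈fy → Uniqueₚ.Unique[x∷xs]⇒x∉xs S₁ x∷xs! (∈-resp-≈ S₁ (Setoid.sym S₁ (inj (here ≈₁-refl) (there y∈xs) fx≈fy)) y∈xs))

module _ {a ℓ p q} (S : Setoid a ℓ) {P : Pred (Setoid.Carrier S) p} {Q : Pred (Setoid.Carrier S) q}
         (P? : Decidable P) (Q? : Decidable Q)
         (P-resp : P Respects Setoid._≈_ S) (Q-resp : Q Respects Setoid._≈_ S) where
  open Setoid S renaming (Carrier to A)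

  length-filter-≤-by-injection : ∀ {xs} → Unique S xs → IsEnumeration S xs → (f : A → A) →
                                 (∀ {x} → P x → Q (f x)) →
                                 (∀ {x y} → P x → P y → f x ≈ f y → x ≈ y) →
                                 length (filter P? xs) ≤ length (filter Q? xs)
  length-filter-≤-by-injection {xs} xs! enum f P⇒Q inj =
    length-≤-by-injection S S (Uniqueₚ.filter⁺ S P? xs!)
      (λ {x} x∈ → ∈-filter⁺ S Q? Q-resp (enum (f x)) (P⇒Q (P-of x∈)))
      (λ x∈ y∈ → inj (P-of x∈) (P-of y∈))
    where
    open SetoidMembership S using () renaming (_∈_ to _∈ₛ_)
    P-of : ∀ {x} → x ∈ₛ filter P? xs → P x
    P-of x∈ = proj₂ (∈-filter⁻ S P? P-resp {xs = xs} x∈)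

module _ {K : ℕ} where

  allFuns-complete : ∀ n → IsEnumeration (Fin n →-setoid Fin K) (allFuns n K)
  allFuns-complete zero f = here (λ ())
  allFuns-complete (suc n) f =
    ∈-concatMap⁺ (setoid (Fin K)) (Fin (suc n) →-setoid Fin K)
      (lose (∈-allFin (f zero))
        (∈-resp-≈ (Fin (suc n) →-setoid Fin K) (λ { zero → refl ; (suc x) → refl })
          (∈-map⁺ (Fin n →-setoid Fin K) (Fin (suc n) →-setoid Fin K)
            (λ g≗h → λ { zero → refl ; (suc x) → g≗h x }) (allFuns-complete n (f ∘ suc)))))

  allFuns-unique : ∀ n → Unique (Fin n →-setoid Fin K) (allFuns n K)
  allFuns-unique zero    = [] ∷ []
  allFuns-unique (suc n) = Uniqueₚ.concat⁺ S₊
    (All.map⁺ (All.universal (λ _ → Uniqueₚ.map⁺ S S₊ (λ eq x → eq (suc x)) (allFuns-unique n)) (allFin K)))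
    (AllPairs.map⁺ (AllPairs.map
      (λ a≢b {_} → disjoint (All.map⁺ (All.universal (λ _ → refl) _))
                            (All.map⁺ (All.universal (λ _ → refl) _)) a≢b)
      (allFin⁺ K)))
    where
    S S₊ : Setoid 0ℓ 0ℓ
    S  = Fin n →-setoid Fin K
    S₊ = Fin (suc n) →-setoid Fin K
    open SetoidMembership S₊ using () renaming (_∈_ to _∈ₛ_)

    head-≡ : ∀ {a v xs} → All.All (λ f → f zero ≡ a) xs → v ∈ₛ xs → v zero ≡ a
    head-≡ {a} {v} = All.lookupWith {R = λ _ → v zero ≡ a} (λ f0≡a v≗f → trans (v≗f zero) f0≡a)

    disjoint : ∀ {a b xs ys} → All.All (λ f → f zero ≡ a) xs → All.All (λ f → f zero ≡ b) ys → a ≢ b →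
               Disjoint S₊ xs ys
    disjoint xs-heads ys-heads a≢b (v∈xs , v∈ys) = a≢b (trans (sym (head-≡ xs-heads v∈xs)) (head-≡ ys-heads v∈ys))

T-allB⇔All : ∀ {A : Set} (p : A → Bool) (xs : List A) → T (allB p xs) ⇔ All.All (T ∘ p) xs
T-allB⇔All p []       = mk⇔ (λ _ → []) (λ _ → tt)
T-allB⇔All p (x ∷ xs) = mk⇔
  (λ px∧rest → let px , rest = Equivalence.to T-∧ px∧rest in px All.∷ Equivalence.to (T-allB⇔All p xs) rest)
  (λ { (px All.∷ pxs) → Equivalence.from T-∧ (px , Equivalence.from (T-allB⇔All p xs) pxs) })

T-allB-allFin : ∀ {n} (p : Fin n → Bool) → T (allB p (allFin n)) ⇔ (∀ v → T (p v))
T-allB-allFin p = mk⇔ (All.tabulate⁻ ∘ Equivalence.to (T-allB⇔All p _))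
                      (Equivalence.from (T-allB⇔All p _) ∘ All.tabulate⁺)

T-not-∨-not : ∀ {x y} → T (not x ∨ not y) ⇔ (T x → ¬ T y)
T-not-∨-not {false}        = mk⇔ (λ _ ()) _
T-not-∨-not {true} {false} = mk⇔ (λ _ _ ()) _
T-not-∨-not {true} {true}  = mk⇔ (λ ()) (λ Tx⇒¬Ty → Tx⇒¬Ty tt tt)

T-toℕ-≡ᵇ : ∀ {K} {x y : Fin K} → T (toℕ x ≡ᵇ toℕ y) ⇔ x ≡ y
T-toℕ-≡ᵇ {x = x} {y} = mk⇔ (toℕ-injective ∘ ≡ᵇ⇒≡ (toℕ x) (toℕ y)) (≡⇒≡ᵇ (toℕ x) (toℕ y) ∘ cong toℕ)

module _ {n K : ℕ} where

  FromLists : ListAssignment n → (Fin n → Fin K) → Set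
  FromLists L c = ∀ v → T (L v (toℕ (c v)))

  Proper : Graph n → (Fin n → Fin K) → Set
  Proper G c = ∀ {u v} → T (adj G u v) → c u ≢ c v

  T-allB-edges⇔Proper : ∀ G (c : Fin n → Fin K) →
    T (allB (λ u → allB (λ v → not (adj G u v) ∨ not (toℕ (c u) ≡ᵇ toℕ (c v))) (allFin n)) (allFin n)) ⇔ Proper G c
  T-allB-edges⇔Proper G c = mk⇔
    (λ t {u} {v} uv → Equivalence.to T-not-∨-not (Equivalence.to (T-allB-allFin _) (Equivalence.to (T-allB-allFin _) t u) v) uv
                       ∘ Equivalence.from T-toℕ-≡ᵇ)
    (λ proper → Equivalence.from (T-allB-allFin _) λ u → Equivalence.from (T-allB-allFin _) λ v →
                  Equivalence.from T-not-∨-not λ uv → proper {u} {v} uv ∘ Equivalence.to T-toℕ-≡ᵇ)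

  isLColouring⇔ : ∀ G L (c : Fin n → Fin K) → T (isLColouring G L c) ⇔ (FromLists L c × Proper G c)
  isLColouring⇔ G L c = ⇔-trans T-∧ (T-allB-allFin _ ×-⇔ T-allB-edges⇔Proper G c)

  isLColouring-resp : ∀ G L → (λ c → T (isLColouring G L c)) Respects (_≗_ {A = Fin n} {B = Fin K})
  isLColouring-resp G L {c} {c′} c≗c′ t =
    let fromLists , proper = Equivalence.to (isLColouring⇔ G L c) t in
    Equivalence.from (isLColouring⇔ G L c′)
      ( (λ v → subst (λ x → T (L v (toℕ x))) (c≗c′ v) (fromLists v))
      , λ {u} {v} uv c′u≡c′v → proper uv (trans (c≗c′ u) (trans c′u≡c′v (sym (c≗c′ v)))))

x∉p⇒p⊂p∪⁅x⁆ : ∀ {n} {x : Fin n} {p : Subset n} → x ∉ p → p Subset.⊂ p ∪ ⁅ x ⁆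
x∉p⇒p⊂p∪⁅x⁆ {x = x} x∉p = p⊆p∪q ⁅ x ⁆ , x , x∈p∪q⁺ (inj₂ (x∈⁅x⁆ x)) , x∉p

Closed : ∀ {n r ℓ} → Rel (Fin n) r → Pred (Fin n) ℓ → Set _
Closed R Q = ∀ {u v} → R u v → Q u → Q v

module Closure {n s r} {P : Pred (Fin n) s} {R : Rel (Fin n) r} (P? : Decidable P) (R? : Decidable₂ R) where

  private
    Derivable : Subset n → Pred (Fin n) _
    Derivable p v = P v ⊎ ∃ λ u → u ∈ p × R u v

    missing? : ∀ p → Dec (∃ λ v → v ∉ p × Derivable p v)
    missing? p = any? λ v → ¬? (v ∈? p) ×-dec (P? v ⊎-dec any? λ u → (u ∈? p) ×-dec R? u v)

    closure′ : ∀ p → Acc _⊃_ p → Subset n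
    closure′ p (acc rs) with missing? p
    ... | yes (v , v∉p , _) = closure′ (p ∪ ⁅ v ⁆) (rs (x∉p⇒p⊂p∪⁅x⁆ v∉p))
    ... | no _              = p

  closure : Subset n
  closure = closure′ Subset.⊥ (⊃-wellFounded _)

  private
    closure′-saturated : ∀ p a → Derivable (closure′ p a) ⊆ (_∈ closure′ p a)
    closure′-saturated p (acc rs) {v} with missing? p
    ... | yes (_ , v∉p , _)  = closure′-saturated _ (rs (x∉p⇒p⊂p∪⁅x⁆ v∉p))
    ... | no nothing-missing = λ v-derivable →
      decidable-stable (v ∈? p) (λ v∉p → nothing-missing (v , v∉p , v-derivable))

    closure′-least : ∀ {ℓ} {Q : Pred (Fin n) ℓ} → P ⊆ Q → Closed R Q →
                     ∀ p a → (_∈ p) ⊆ Q → (_∈ closure′ p a) ⊆ Q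
    closure′-least {Q = Q} P⊆Q Q-closed p (acc rs) p⊆Q with missing? p
    ... | no _ = p⊆Q
    ... | yes (v , v∉p , v-derivable) = closure′-least P⊆Q Q-closed _ (rs (x∉p⇒p⊂p∪⁅x⁆ v∉p)) p∪v⊆Q
      where
      Qv : Q v
      Qv = [ P⊆Q , (λ (u , u∈p , Ruv) → Q-closed Ruv (p⊆Q u∈p)) ] v-derivable
      p∪v⊆Q : (_∈ p ∪ ⁅ v ⁆) ⊆ Q
      p∪v⊆Q x∈ = [ p⊆Q , (λ x∈⁅v⁆ → subst Q (sym (x∈⁅y⁆⇒x≡y v x∈⁅v⁆)) Qv) ] (x∈p∪q⁻ p ⁅ v ⁆ x∈)

  closure-⊇ : P ⊆ (_∈ closure)
  closure-⊇ Pv = closure′-saturated _ _ (inj₁ Pv)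

  closure-closed : Closed R (_∈ closure)
  closure-closed Ruv u∈ = closure′-saturated _ _ (inj₂ (_ , u∈ , Ruv))

  closure-least : ∀ {ℓ} {Q : Pred (Fin n) ℓ} → P ⊆ Q → Closed R Q → (_∈ closure) ⊆ Q
  closure-least P⊆Q Q-closed = closure′-least P⊆Q Q-closed _ _ (λ v∈⊥ → contradiction v∈⊥ ∉⊥)

closure-mono : ∀ {n s s′ r r′} {P : Pred (Fin n) s} {P′ : Pred (Fin n) s′} {R : Rel (Fin n) r} {R′ : Rel (Fin n) r′}
               (P? : Decidable P) (P′? : Decidable P′) (R? : Decidable₂ R) (R′? : Decidable₂ R′) →
               P ⊆ P′ → (∀ {u v} → R u v → R′ u v) →
               (_∈ Closure.closure P? R?) ⊆ (_∈ Closure.closure P′? R′?)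
closure-mono P? P′? R? R′? P⊆P′ R⇒R′ =
  Closure.closure-least P? R? (Closure.closure-⊇ P′? R′? ∘ P⊆P′) (Closure.closure-closed P′? R′? ∘ R⇒R′)

Cset-lost : ∀ i j (S : NSet) x → T (S x) → ¬ T (Cset i j S x) → x ≡ j × ¬ T (S i)
Cset-lost i j S x Sx x∉C with S j | S i
... | false | _     = contradiction Sx x∉C
... | true  | true  = contradiction Sx x∉C
... | true  | false with x ≡ᵇ i
...   | true  = contradiction tt x∉C
...   | false with x ≡ᵇ j in x≡ᵇj
...     | true  = ≡ᵇ⇒≡ x j (subst T (sym x≡ᵇj) tt) , λ ()
...     | false = contradiction Sx x∉C

Cset-gained : ∀ i j (S : NSet) → T (S j) → T (Cset i j S i)
Cset-gained i j S Sj with S j | S i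
... | false | _     = contradiction Sj λ ()
... | true  | true  = tt
... | true  | false with i ≡ᵇ i | ≡⇒≡ᵇ i i refl
...   | true | _ = tt

module KempeSwitch {n} (G : Graph n) (side : Fin n → Bool) (bip : IsBipartition G side)
                   (L : ListAssignment n) {K} {a b : Fin K} (a≢b : a ≢ b) where

  L′ : ListAssignment n
  L′ = CL side (toℕ a) (toℕ b) L

  IsAB : Pred (Fin K) _
  IsAB x = x ≡ a ⊎ x ≡ b

  -- aligned v is the colour of {i, j} that C_ij may add to the list of v, anti v the one it may remove.
  aligned anti : Fin n → Fin K
  aligned v = if side v then a else b
  anti    v = if side v then b else a

  sides-differ : ∀ {u v} → T (adj G u v) → side u ≢ side v
  sides-differ {u} {v} uv = bip u v (Equivalence.to T-≡ uv)

  aligned-isAB : ∀ v → IsAB (aligned v)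
  aligned-isAB v with side v
  ... | true  = inj₁ refl
  ... | false = inj₂ refl

  anti-isAB : ∀ v → IsAB (anti v)
  anti-isAB v with side v
  ... | true  = inj₂ refl
  ... | false = inj₁ refl

  aligned-distinct : ∀ {u v} → side u ≢ side v → aligned u ≢ aligned v
  aligned-distinct {u} {v} su≢sv with side u | side v
  ... | true  | true  = contradiction refl su≢sv
  ... | true  | false = a≢b
  ... | false | true  = a≢b ∘ sym
  ... | false | false = contradiction refl su≢sv

  anti-opposite : ∀ {u v x} → side u ≢ side v → IsAB x → x ≢ anti u → x ≡ anti v
  anti-opposite {u} {v} su≢sv x-isAB x≢anti-u with side u | side v | x-isAB
  ... | true  | true  | _         = contradiction refl su≢sv
  ... | false | false | _         = contradiction refl su≢sv
  ... | true  | false | inj₁ x≡a = x≡a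
  ... | true  | false | inj₂ x≡b = contradiction x≡b x≢anti-u
  ... | false | true  | inj₁ x≡a = contradiction x≡a x≢anti-u
  ... | false | true  | inj₂ x≡b = x≡b

  L′-lost : ∀ {v x} → T (L v (toℕ x)) → ¬ T (L′ v (toℕ x)) → x ≡ anti v × ¬ T (L v (toℕ (aligned v)))
  L′-lost {v} {x} x∈Lv x∉L′v with side v | Cset-lost (toℕ a) (toℕ b) (L v) (toℕ x) x∈Lv | Cset-lost (toℕ b) (toℕ a) (L v) (toℕ x) x∈Lv
  ... | true  | lost | _ = let x≡b , a∉Lv = lost x∉L′v in toℕ-injective x≡b , a∉Lv
  ... | false | _ | lost = let x≡a , b∉Lv = lost x∉L′v in toℕ-injective x≡a , b∉Lv

  L′-gained : ∀ {v} → T (L v (toℕ (anti v))) → T (L′ v (toℕ (aligned v)))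
  L′-gained {v} with side v
  ... | true  = Cset-gained (toℕ a) (toℕ b) (L v)
  ... | false = Cset-gained (toℕ b) (toℕ a) (L v)

  Colouring : Set
  Colouring = Fin n → Fin K

  KempeEdge : Colouring → Rel (Fin n) _
  KempeEdge c u v = T (adj G u v) × IsAB (c u) × IsAB (c v)

  Misfit : ListAssignment n → Colouring → Pred (Fin n) _
  Misfit M c v = ¬ T (M v (toℕ (c v)))

  misfit? : ∀ M c → Decidable (Misfit M c)
  misfit? M c v = ¬? (T? (M v (toℕ (c v))))

  isAB? : Decidable IsAB
  isAB? x = x ≟ a ⊎-dec x ≟ b

  kempeEdge? : ∀ c → Decidable₂ (KempeEdge c)
  kempeEdge? c u v = T? (adj G u v) ×-dec isAB? (c u) ×-dec isAB? (c v)

  kempeSet : ListAssignment n → Colouring → Subset n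
  kempeSet M c = Closure.closure (misfit? M c) (kempeEdge? c)

  module _ (M : ListAssignment n) (c : Colouring) where
    open Closure (misfit? M c) (kempeEdge? c) public
      using () renaming (closure-⊇ to kempeSet-⊇; closure-closed to kempeSet-closed; closure-least to kempeSet-least)

  kempeSet-resp : ∀ M {d d′} → d ≗ d′ → (_∈ kempeSet M d) ⊆ (_∈ kempeSet M d′)
  kempeSet-resp M d≗d′ = closure-mono _ _ _ _
    (λ {v} misfit → misfit ∘ subst (λ x → T (M v (toℕ x))) (sym (d≗d′ v)))
    (λ {u} {v} (uv , du , dv) → uv , subst IsAB (d≗d′ u) du , subst IsAB (d≗d′ v) dv)

  switch : Subset n → (Fin n → Fin K) → Colouring → Colouring
  switch S new c v = if does (v ∈? S) then new v else c v

  compress decompress : Colouring → Colouring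
  compress   c = switch (kempeSet L′ c) aligned c
  decompress d = switch (kempeSet L d) anti d

  private
    switch-∈ : ∀ S new c {v} → v ∈ S → switch S new c v ≡ new v
    switch-∈ S _ _ {v} v∈S with v ∈? S
    ... | yes _   = refl
    ... | no v∉S  = contradiction v∈S v∉S

    switch-∉ : ∀ S new c {v} → v ∉ S → switch S new c v ≡ c v
    switch-∉ S _ _ {v} v∉S with v ∈? S
    ... | yes v∈S = contradiction v∈S v∉S
    ... | no _    = refl

  compress-∈ : ∀ c {v} → v ∈ kempeSet L′ c → compress c v ≡ aligned v
  compress-∈ c = switch-∈ (kempeSet L′ c) aligned c

  compress-∉ : ∀ c {v} → v ∉ kempeSet L′ c → compress c v ≡ c v
  compress-∉ c = switch-∉ (kempeSet L′ c) aligned c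

  decompress-∈ : ∀ d {v} → v ∈ kempeSet L d → decompress d v ≡ anti v
  decompress-∈ d = switch-∈ (kempeSet L d) anti d

  decompress-∉ : ∀ d {v} → v ∉ kempeSet L d → decompress d v ≡ d v
  decompress-∉ d = switch-∉ (kempeSet L d) anti d

  decompress-resp : ∀ {d d′} → d ≗ d′ → decompress d ≗ decompress d′
  decompress-resp {d} {d′} d≗d′ v = [ inside , outside ]′ (toSum (v ∈? kempeSet L d))
    where
    inside : v ∈ kempeSet L d → decompress d v ≡ decompress d′ v
    inside v∈ = trans (decompress-∈ d v∈) (sym (decompress-∈ d′ (kempeSet-resp L d≗d′ v∈)))
    outside : v ∉ kempeSet L d → decompress d v ≡ decompress d′ v
    outside v∉ = trans (decompress-∉ d v∉) (trans (d≗d′ v) (sym (decompress-∉ d′ (v∉ ∘ kempeSet-resp L (sym ∘ d≗d′)))))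

  module _ {c : Colouring} (c-fromLists : FromLists L c) (c-proper : Proper G c) where

    kempeSet-anti : ∀ {v} → v ∈ kempeSet L′ c → c v ≡ anti v
    kempeSet-anti = kempeSet-least L′ c (λ {v} misfit → proj₁ (L′-lost (c-fromLists v) misfit)) anti-closed
      where
      anti-closed : Closed (KempeEdge c) (λ v → c v ≡ anti v)
      anti-closed (uv , _ , cv-isAB) cu≡anti-u =
        anti-opposite (sides-differ uv) cv-isAB (λ cv≡anti-u → c-proper uv (trans cu≡anti-u (sym cv≡anti-u)))

    compress-fromLists : FromLists L′ (compress c)
    compress-fromLists v with v ∈? kempeSet L′ c
    ... | yes v∈S = L′-gained (subst (λ x → T (L v (toℕ x))) (kempeSet-anti v∈S) (c-fromLists v))
    ... | no v∉S  = decidable-stable (T? _) (v∉S ∘ kempeSet-⊇ L′ c)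

    aligned≢outside : ∀ {u v} → T (adj G u v) → u ∈ kempeSet L′ c → v ∉ kempeSet L′ c → aligned u ≢ c v
    aligned≢outside {u} uv u∈S v∉S aligned≡cv = v∉S (kempeSet-closed L′ c
      (uv , subst IsAB (sym (kempeSet-anti u∈S)) (anti-isAB u) , subst IsAB aligned≡cv (aligned-isAB u)) u∈S)

    compress-proper : Proper G (compress c)
    compress-proper {u} {v} uv with u ∈? kempeSet L′ c | v ∈? kempeSet L′ c
    ... | yes _   | yes _   = aligned-distinct (sides-differ uv)
    ... | no _    | no _    = c-proper uv
    ... | yes u∈S | no v∉S  = aligned≢outside uv u∈S v∉S
    ... | no u∉S  | yes v∈S = aligned≢outside (subst T (Graph.sym G u v) uv) v∈S u∉S ∘ sym

    compress-isAB : ∀ {v} → IsAB (c v) → IsAB (compress c v)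
    compress-isAB {v} cv-isAB with v ∈? kempeSet L′ c
    ... | yes _ = aligned-isAB v
    ... | no _  = cv-isAB

    compress-isAB⁻ : ∀ {v} → IsAB (compress c v) → IsAB (c v)
    compress-isAB⁻ {v} with v ∈? kempeSet L′ c
    ... | yes v∈S = λ _ → subst IsAB (sym (kempeSet-anti v∈S)) (anti-isAB v)
    ... | no _    = id

    kempeSet-compress : ∀ {v} → v ∈ kempeSet L (compress c) → v ∈ kempeSet L′ c
    kempeSet-compress = kempeSet-least L (compress c) misfit⇒∈S
      (λ (uv , u-isAB , v-isAB) → kempeSet-closed L′ c (uv , compress-isAB⁻ u-isAB , compress-isAB⁻ v-isAB))
      where
      misfit⇒∈S : Misfit L (compress c) ⊆ (_∈ kempeSet L′ c)
      misfit⇒∈S {v} misfit with v ∈? kempeSet L′ c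
      ... | yes v∈S = v∈S
      ... | no _    = contradiction (c-fromLists v) misfit

    kempeSet-compress⁻ : ∀ {v} → v ∈ kempeSet L′ c → v ∈ kempeSet L (compress c)
    kempeSet-compress⁻ = kempeSet-least L′ c misfit⇒∈S′
      (λ (uv , u-isAB , v-isAB) → kempeSet-closed L (compress c) (uv , compress-isAB u-isAB , compress-isAB v-isAB))
      where
      misfit⇒∈S′ : Misfit L′ c ⊆ (_∈ kempeSet L (compress c))
      misfit⇒∈S′ {v} misfit = kempeSet-⊇ L (compress c)
        (subst (λ x → ¬ T (L v (toℕ x))) (sym (compress-∈ c (kempeSet-⊇ L′ c misfit))) (proj₂ (L′-lost (c-fromLists v) misfit)))

    decompress-compress : decompress (compress c) ≗ c
    decompress-compress v = [ inside , outside ]′ (toSum (v ∈? kempeSet L′ c))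
      where
      inside : v ∈ kempeSet L′ c → decompress (compress c) v ≡ c v
      inside v∈S = trans (decompress-∈ (compress c) (kempeSet-compress⁻ v∈S)) (sym (kempeSet-anti v∈S))
      outside : v ∉ kempeSet L′ c → decompress (compress c) v ≡ c v
      outside v∉S = trans (decompress-∉ (compress c) (v∉S ∘ kempeSet-compress)) (compress-∉ c v∉S)

  compress-injective : ∀ {c₁ c₂} → FromLists L c₁ × Proper G c₁ → FromLists L c₂ × Proper G c₂ →
                       compress c₁ ≗ compress c₂ → c₁ ≗ c₂
  compress-injective (l₁ , p₁) (l₂ , p₂) eq v =
    trans (sym (decompress-compress l₁ p₁ v)) (trans (decompress-resp eq v) (decompress-compress l₂ p₂ v))

  countCol-≤ : countCol K G L ≤ countCol K G L′
  countCol-≤ = length-filter-≤-by-injection (Fin n →-setoid Fin K)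
    (T? ∘ isLColouring G L) (T? ∘ isLColouring G L′) (isLColouring-resp G L) (isLColouring-resp G L′)
    (allFuns-unique n) (allFuns-complete n) compress
    (λ {c} isL → let l , p = colouring c isL in
      Equivalence.from (isLColouring⇔ G L′ (compress c)) (compress-fromLists l p , compress-proper l p))
    (λ isL₁ isL₂ → compress-injective (colouring _ isL₁) (colouring _ isL₂))
    where
    colouring : ∀ c → T (isLColouring G L c) → FromLists L c × Proper G c
    colouring c = Equivalence.to (isLColouring⇔ G L c)

lemma3p1 : ∀ {n} (G : Graph n) (side : Fin n → Bool) → IsBipartition G side →
    (L : ListAssignment n) →
    (∀ v → L v 0 ≡ false) →
    (K : ℕ) → (∀ v x → L v x ≡ true → x < K) →
    (i j : ℕ) → 1 ≤ i → 1 ≤ j → ¬ (i ≡ j) → i < K → j < K →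
    countCol K G L ≤ countCol K G (CL side i j L)
lemma3p1 G side bip L _ K _ i j _ _ i≢j i<K j<K =
  subst₂ (λ i j → countCol K G L ≤ countCol K G (CL side i j L)) (toℕ-fromℕ< i<K) (toℕ-fromℕ< j<K)
    (KempeSwitch.countCol-≤ G side bip L (i≢j ∘ fromℕ<-injective i j i<K j<K))
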